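{- Let $R$ be a commutative ring with $1$ and $\mathcal{A}$ a set of non-commuting symbols. The map sending a normalized $R$-valued multiple Dedekind symbol $D_{\mathcal{A}}$ based on $\mathcal{A}$ to its associated function $(p,q)\mapsto D_{\mathcal{A}}(p,q)D_{\mathcal{A}}(-q,p)^{ -1}$ is a bijection from the set of normalized $R$-valued multiple Dedekind symbols based on $\mathcal{A}$ onto the set of $R$-valued multiple reciprocity functions based on $\mathcal{A}$.
   Context: $\mathcal{A}^{*}$ denotes the set of words in $\mathcal{A}$ (including the empty word $\emptyset$) with concatenation; $R\langle\langle\mathcal{A}\rangle\rangle$ is the ring of formal power series $\sum_{w\in\mathcal{A}^*}c_w w$ ($c_w\in R$) in the non-commuting symbols and $R\langle\langle\mathcal{A}\rangle\rangle^{\times}$ its unit group. Let $U=\{(p,q)\in\mathbb{Z}^2:\gcd(p,q)=1\}$. For a group $G$, a $G$-valued Dedekind symbol is $D:U\to G$ with $D(p,-q)=D(-p,q)$ and $D(p,q)=D(p,p+q)$; a $G$-valued reciprocity function is $F:U\to G$ with $F(p,-q)=F(-p,q)$, $F(p,q)F(-q,p)=1$ and $F(p,p+q)F(p+q,q)=F(p,q)$ for all $(p,q)\in U$. An $R$-valued multiple Dedekind symbol (resp. multiple reciprocity function) based on $\mathcal{A}$ is an $R\langle\langle\mathcal{A}\rangle\rangle^{\times}$-valued Dedekind symbol (resp. reciprocity function) of the form $1+\sum_{\emptyset\neq w\in\mathcal{A}^*}D^{w}(p,q)w$ with $D^w:U\to R$. A multiple Dedekind symbol $D_{\mathcal{A}}$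 is normalized if $D_{\mathcal{A}}(1,1)=1$. -}

module Defs where

open import Level using (Level; _⊔_)
open import Algebra.Bundles using (CommutativeRing)
open import Data.List using (List; []; _∷_)
open import Data.Product using (_×_; Σ-syntax)
open import Data.Integer using (ℤ; +_) renaming (_+_ to _+ℤ_; -_ to -ℤ_)
open import Data.Integer.GCD using (gcd)
open import Relation.Binary.PropositionalEquality using (_≡_)

Coprimeℤ : ℤ → ℤ → Set
Coprimeℤ p q = gcd p q ≡ + 1

module MultipleDedekind {c ℓ a : Level} (R : CommutativeRing c ℓ) (𝒜 : Set a) where
  open CommutativeRing R

  -- words in 𝒜 (the empty list is the empty word); formal power series
  -- R⟨⟨𝒜⟩⟩ are coefficient functions on words
  Word : Set a
  Word = List 𝒜

  Series : Set (a ⊔ c)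
  Series = Word → Carrier

  _≈ₛ_ : Series → Series → Set (a ⊔ ℓ)
  f ≈ₛ g = ∀ w → f w ≈ g w

  one : Series
  one []      = 1#
  one (_ ∷ _) = 0#

  -- Cauchy product: (f ⊛ g)(w) = Σ_{uv = w} f(u) g(v)
  _⊛_ : Series → Series → Series
  (f ⊛ g) []      = f [] * g []
  (f ⊛ g) (x ∷ w) = f [] * g (x ∷ w) + ((λ u → f (x ∷ u)) ⊛ g) w

  -- inverse of a series with constant term 1 (the unique g with f ⊛ g = 1):
  -- g [] = 1,  g (x ∷ w) = - Σ_{uv = w} f (x ∷ u) g(v)
  inv : Series → Series
  invSum : Series → Series → Word → Carrier
  inv f []      = 1#
  inv f (x ∷ w) = - invSum f (λ u → f (x ∷ u)) w
  -- invSum f h w = Σ_{uv = w} h(u) (inv f)(v)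
  invSum f h []      = h [] * inv f []
  invSum f h (y ∷ w) = h [] * inv f (y ∷ w) + invSum f (λ u → h (y ∷ u)) w

  -- functions U → R⟨⟨𝒜⟩⟩, represented as functions on ℤ² whose values
  -- off U are irrelevant
  SymbolFn : Set (a ⊔ c)
  SymbolFn = ℤ → ℤ → Series

  _≈U_ : SymbolFn → SymbolFn → Set (a ⊔ ℓ)
  D ≈U D' = ∀ p q → Coprimeℤ p q → D p q ≈ₛ D' p q

  HasConstOne : SymbolFn → Set ℓ
  HasConstOne D = ∀ p q → Coprimeℤ p q → D p q [] ≈ 1#

  IsMultipleDedekindSymbol : SymbolFn → Set (a ⊔ ℓ)
  IsMultipleDedekindSymbol D =
    HasConstOne D
    × (∀ p q → Coprimeℤ p q → D p (-ℤ q) ≈ₛ D (-ℤ p) q)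
    × (∀ p q → Coprimeℤ p q → D p q ≈ₛ D p (p +ℤ q))

  IsNormalizedMultipleDedekindSymbol : SymbolFn → Set (a ⊔ ℓ)
  IsNormalizedMultipleDedekindSymbol D =
    IsMultipleDedekindSymbol D × (D (+ 1) (+ 1) ≈ₛ one)

  IsMultipleReciprocityFunction : SymbolFn → Set (a ⊔ ℓ)
  IsMultipleReciprocityFunction F =
    HasConstOne F
    × (∀ p q → Coprimeℤ p q → F p (-ℤ q) ≈ₛ F (-ℤ p) q)
    × (∀ p q → Coprimeℤ p q → (F p q ⊛ F (-ℤ q) p) ≈ₛ one)
    × (∀ p q → Coprimeℤ p q → (F p (p +ℤ q) ⊛ F (p +ℤ q) q) ≈ₛ F p q)

  assoc : SymbolFn → SymbolFn
  assoc D p q = D p q ⊛ inv (D (-ℤ q) p)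

-- A Dedekind symbol D and its associated function F(p,q) = D(p,q) D(-q,p)⁻¹ satisfy the
-- reciprocity law D(p,q) = F(p,q) D(-q,p). Combined with periodicity D(p,q) = D(p,p+q), the law
-- runs the Euclidean algorithm: reducing q modulo p and rotating (p,q) to (-q,p) lowers |p| until
-- (1,0) is reached, where normalization gives D = 1, so D is determined by F. Conversely, for a
-- reciprocity function F the same recursion defines D on reduced pairs (p,r), 0 ≤ r < p; the
-- three-term relation propagates the law from (p,q) and (p+q,q) to (p,p+q), and the relation
-- F(p,q) F(-q,p) = 1 makes it invariant under rotation, so the law holds on all of U.
module Submission where

open import Level using (Level; _⊔_)
open import Algebra.Bundles using (CommutativeRing; Monoid; AbelianGroup)
open import Data.List.Base using ([]; _∷_)
open import Data.Product using (_×_; _,_; Σ-syntax)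
import Relation.Binary.Reasoning.Setoid as SetoidReasoning
open import Defs

-- The monoid of formal power series

module SeriesMonoid {c ℓ a : Level} (R : CommutativeRing c ℓ) (𝒜 : Set a) where
  open CommutativeRing R
  open MultipleDedekind R 𝒜
  open import Algebra.Properties.CommutativeSemigroup +-commutativeSemigroup using (interchange)
  module ≈-Reasoning = SetoidReasoning setoid

  private
    ∂ : 𝒜 → Series → Series
    ∂ x f u = f (x ∷ u)

    _⊕_ : Series → Series → Series
    (f ⊕ g) w = f w + g w

    _·_ : Carrier → Series → Series
    (k · f) w = k * f w

    zeroₛ : Series
    zeroₛ _ = 0#

  ⊛-cong : ∀ {f f′ g g′} → f ≈ₛ f′ → g ≈ₛ g′ → (f ⊛ g) ≈ₛ (f′ ⊛ g′)
  ⊛-cong f≈f′ g≈g′ []      = *-cong (f≈f′ []) (g≈g′ [])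
  ⊛-cong f≈f′ g≈g′ (x ∷ w) =
    +-cong (*-cong (f≈f′ []) (g≈g′ (x ∷ w))) (⊛-cong (λ u → f≈f′ (x ∷ u)) g≈g′ w)

  private
    ⊛-distribʳ-⊕ : ∀ f g h → ((f ⊕ g) ⊛ h) ≈ₛ ((f ⊛ h) ⊕ (g ⊛ h))
    ⊛-distribʳ-⊕ f g h []      = distribʳ (h []) (f []) (g [])
    ⊛-distribʳ-⊕ f g h (x ∷ w) = begin
      (f [] + g []) * h (x ∷ w) + ((∂ x f ⊕ ∂ x g) ⊛ h) w
        ≈⟨ +-cong (distribʳ (h (x ∷ w)) (f []) (g [])) (⊛-distribʳ-⊕ (∂ x f) (∂ x g) h w) ⟩
      (f [] * h (x ∷ w) + g [] * h (x ∷ w)) + ((∂ x f ⊛ h) w + (∂ x g ⊛ h) w)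
        ≈⟨ interchange _ _ _ _ ⟩
      (f ⊛ h) (x ∷ w) + (g ⊛ h) (x ∷ w) ∎
      where open ≈-Reasoning

    ⊛-assoc-· : ∀ k f h → ((k · f) ⊛ h) ≈ₛ (k · (f ⊛ h))
    ⊛-assoc-· k f h []      = *-assoc k (f []) (h [])
    ⊛-assoc-· k f h (x ∷ w) = begin
      k * f [] * h (x ∷ w) + ((k · ∂ x f) ⊛ h) w
        ≈⟨ +-cong (*-assoc k (f []) (h (x ∷ w))) (⊛-assoc-· k (∂ x f) h w) ⟩
      k * (f [] * h (x ∷ w)) + k * (∂ x f ⊛ h) w
        ≈⟨ distribˡ k _ _ ⟨
      k * (f ⊛ h) (x ∷ w) ∎
      where open ≈-Reasoning

    ⊛-zeroˡ : ∀ g → (zeroₛ ⊛ g) ≈ₛ zeroₛ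
    ⊛-zeroˡ g []      = zeroˡ (g [])
    ⊛-zeroˡ g (x ∷ w) = trans (+-cong (zeroˡ _) (⊛-zeroˡ g w)) (+-identityˡ 0#)

  ⊛-assoc : ∀ f g h → ((f ⊛ g) ⊛ h) ≈ₛ (f ⊛ (g ⊛ h))
  ⊛-assoc f g h []      = *-assoc (f []) (g []) (h [])
  ⊛-assoc f g h (x ∷ w) = begin
    (f [] * g []) * h (x ∷ w) + (((f [] · ∂ x g) ⊕ (∂ x f ⊛ g)) ⊛ h) w
      ≈⟨ +-congˡ (⊛-distribʳ-⊕ (f [] · ∂ x g) (∂ x f ⊛ g) h w) ⟩
    (f [] * g []) * h (x ∷ w) + (((f [] · ∂ x g) ⊛ h) w + ((∂ x f ⊛ g) ⊛ h) w)
      ≈⟨ +-congˡ (+-cong (⊛-assoc-· (f []) (∂ x g) h w) (⊛-assoc (∂ x f) g h w)) ⟩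
    (f [] * g []) * h (x ∷ w) + (f [] * (∂ x g ⊛ h) w + (∂ x f ⊛ (g ⊛ h)) w)
      ≈⟨ +-assoc _ _ _ ⟨
    ((f [] * g []) * h (x ∷ w) + f [] * (∂ x g ⊛ h) w) + (∂ x f ⊛ (g ⊛ h)) w
      ≈⟨ +-congʳ (trans (+-congʳ (*-assoc (f []) (g []) (h (x ∷ w)))) (sym (distribˡ (f []) _ _))) ⟩
    f [] * (g ⊛ h) (x ∷ w) + (∂ x f ⊛ (g ⊛ h)) w ∎
    where open ≈-Reasoning

  ⊛-identityˡ : ∀ g → (one ⊛ g) ≈ₛ g
  ⊛-identityˡ g []      = *-identityˡ (g [])
  ⊛-identityˡ g (x ∷ w) = trans (+-cong (*-identityˡ _) (⊛-zeroˡ g w)) (+-identityʳ _)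

  ⊛-identityʳ : ∀ f → (f ⊛ one) ≈ₛ f
  ⊛-identityʳ f []      = *-identityʳ (f [])
  ⊛-identityʳ f (x ∷ w) = trans (+-cong (zeroʳ _) (⊛-identityʳ (∂ x f) w)) (+-identityˡ _)

  ⊛-monoid : Monoid _ _
  ⊛-monoid = record
    { Carrier  = Series
    ; _≈_      = _≈ₛ_
    ; _∙_      = _⊛_
    ; ε        = one
    ; isMonoid = record
      { isSemigroup = record
        { isMagma = record
          { isEquivalence = record
            { refl  = λ _ → refl
            ; sym   = λ f≈g w → sym (f≈g w)
            ; trans = λ f≈g g≈h w → trans (f≈g w) (g≈h w)
            }
          ; ∙-cong = ⊛-cong
          }
        ; assoc = ⊛-assoc
        }
      ; identity = ⊛-identityˡ , ⊛-identityʳ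
      }
    }

  open Monoid ⊛-monoid public
    using ()
    renaming ( refl to ≈ₛ-refl; reflexive to ≈ₛ-reflexive; sym to ≈ₛ-sym; trans to ≈ₛ-trans
             ; ∙-congˡ to ⊛-congˡ; ∙-congʳ to ⊛-congʳ)
  open import Algebra.Properties.Monoid ⊛-monoid using (elimʳ; cancelˡ)
  module ≈ₛ-Reasoning = SetoidReasoning (Monoid.setoid ⊛-monoid)

  ConstOne : Series → Set ℓ
  ConstOne f = f [] ≈ 1#

  private
    invSum≈⊛inv : ∀ f h w → invSum f h w ≈ (h ⊛ inv f) w
    invSum≈⊛inv f h []      = refl
    invSum≈⊛inv f h (y ∷ w) = +-congˡ (invSum≈⊛inv f (∂ y h) w)

  inv-inverseʳ : ∀ {f} → ConstOne f → (f ⊛ inv f) ≈ₛ one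
  inv-inverseʳ c []          = trans (*-identityʳ _) c
  inv-inverseʳ {f} c (x ∷ w) = begin
    f [] * (- invSum f (∂ x f) w) + s ≈⟨ +-congʳ (*-cong c (-‿cong (invSum≈⊛inv f (∂ x f) w))) ⟩
    1# * (- s) + s                    ≈⟨ +-congʳ (*-identityˡ _) ⟩
    - s + s                           ≈⟨ -‿inverseˡ s ⟩
    0#                                ∎
    where
    open ≈-Reasoning
    s = (∂ x f ⊛ inv f) w

  inv-inverseˡ : ∀ {f} → ConstOne f → (inv f ⊛ f) ≈ₛ one
  inv-inverseˡ {f} c = ≈ₛ-trans (⊛-congˡ f≈inv[inv[f]]) (inv-inverseʳ refl)
    where
    open ≈ₛ-Reasoning
    f≈inv[inv[f]] : f ≈ₛ inv (inv f)
    f≈inv[inv[f]] = begin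
      f                         ≈⟨ elimʳ (inv-inverseʳ refl) f ⟨
      f ⊛ (inv f ⊛ inv (inv f)) ≈⟨ cancelˡ (inv-inverseʳ c) (inv (inv f)) ⟩
      inv (inv f)               ∎

  inv-cong : ∀ {f f′} → ConstOne f → f ≈ₛ f′ → inv f ≈ₛ inv f′
  inv-cong {f} {f′} c f≈f′ = begin
    inv f                 ≈⟨ elimʳ (inv-inverseʳ (trans (sym (f≈f′ [])) c)) (inv f) ⟨
    inv f ⊛ (f′ ⊛ inv f′) ≈⟨ ⊛-congˡ (⊛-congʳ (≈ₛ-sym f≈f′)) ⟩
    inv f ⊛ (f ⊛ inv f′)  ≈⟨ cancelˡ (inv-inverseˡ c) (inv f′) ⟩
    inv f′                ∎
    where open ≈ₛ-Reasoning

open import Data.Nat.Base as ℕ using (ℕ; zero; suc; z<s; s≤s)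
import Data.Nat.Properties as ℕ
import Data.Nat.DivMod as ℕ
import Data.Nat.Divisibility as ℕ
import Data.Nat.GCD as ℕ
open import Data.Nat.Induction using (<-rec)
open import Data.Integer.Base
  using (ℤ; +_; -[1+_]; _+_; _*_; -_; ∣_∣; _≤_; _<_; +<+; _%ℕ_; _/ℕ_)
  renaming (suc to sucℤ)
open import Data.Integer.Properties
  using (∣-i∣≡∣i∣; neg-involutive; neg-distrib-+; +-identityˡ; +-comm; +-injective; ≤-antisym;
         ≤-<-trans; i≤j+i; +-monoˡ-<; *-cancelʳ-<-nonNeg; i<j⇒i≤pred[j]; pred-suc; suc-*;
         +-0-abelianGroup)
open import Data.Integer.DivMod using (a≡a%ℕn+[a/ℕn]*n; n%ℕd<d; [n/ℕd]*d≤n; n<s[n/ℕd]*d)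
open import Data.Integer.GCD using (gcd; gcd-comm; gcd[i,j]∣i; gcd[i,j]∣j; gcd-greatest)
import Data.Integer.Divisibility as Unsigned
open import Data.Integer.Divisibility.Signed using (_∣_; ∣ᵤ⇒∣; ∣⇒∣ᵤ; ∣m∣n⇒∣m+n; ∣m+n∣m⇒∣n)
open import Data.Integer.Tactic.RingSolver using (solve-∀)
open import Algebra.Properties.Group (AbelianGroup.group +-0-abelianGroup) using (∙-cancelʳ)
open import Relation.Nullary using (yes; no)
open import Relation.Unary using (Pred)
open import Relation.Binary.PropositionalEquality
  using (_≡_; refl; trans; cong; cong₂; subst; module ≡-Reasoning)
import Relation.Binary.PropositionalEquality as ≡

-- Coprimality

gcd[i,i+j]≡gcd[i,j] : ∀ i j → gcd i (i + j) ≡ gcd i j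
gcd[i,i+j]≡gcd[i,j] i j =
  cong +_ (ℕ.∣-antisym (divisors (i + j) j ∣m+n∣m⇒∣n)
                       (divisors j (i + j) (λ c∣j c∣i → ∣m∣n⇒∣m+n c∣i c∣j)))
  where
  divisors : ∀ k l → (∀ {c} → c ∣ k → c ∣ i → c ∣ l) → gcd i k Unsigned.∣ gcd i l
  divisors k l common = gcd-greatest {i} {l} {g} (gcd[i,j]∣i i k)
    (∣⇒∣ᵤ {g} {l} (common (∣ᵤ⇒∣ {g} {k} (gcd[i,j]∣j i k)) (∣ᵤ⇒∣ {g} {i} (gcd[i,j]∣i i k))))
    where g = gcd i k

gcd[-j,i]≡gcd[i,j] : ∀ i j → gcd (- j) i ≡ gcd i j
gcd[-j,i]≡gcd[i,j] i j = trans (cong (λ n → + ℕ.gcd n ∣ i ∣) (∣-i∣≡∣i∣ j)) (gcd-comm j i)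

coprime-sym : ∀ p q → Coprimeℤ p q → Coprimeℤ q p
coprime-sym p q = trans (gcd-comm q p)

coprime-negˡ : ∀ p q → Coprimeℤ p q → Coprimeℤ (- p) q
coprime-negˡ p q c = trans (gcd[-j,i]≡gcd[i,j] q p) (coprime-sym p q c)

coprime-neg : ∀ p q → Coprimeℤ p q → Coprimeℤ (- p) (- q)
coprime-neg p q = trans (cong₂ (λ m n → + ℕ.gcd m n) (∣-i∣≡∣i∣ p) (∣-i∣≡∣i∣ q))

coprime-rotate : ∀ p q → Coprimeℤ p q → Coprimeℤ (- q) p
coprime-rotate p q = trans (gcd[-j,i]≡gcd[i,j] p q)

coprime-unrotate : ∀ p q → Coprimeℤ (- q) p → Coprimeℤ p q
coprime-unrotate p q = trans (≡.sym (gcd[-j,i]≡gcd[i,j] p q))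

coprime-shift : ∀ p q → Coprimeℤ p q → Coprimeℤ p (p + q)
coprime-shift p q = trans (gcd[i,i+j]≡gcd[i,j] p q)

coprime-unshift : ∀ p q → Coprimeℤ p (p + q) → Coprimeℤ p q
coprime-unshift p q = trans (≡.sym (gcd[i,i+j]≡gcd[i,j] p q))

coprime-sum : ∀ p q → Coprimeℤ p q → Coprimeℤ (p + q) q
coprime-sum p q c = begin
  gcd (p + q) q ≡⟨ gcd-comm (p + q) q ⟩
  gcd q (p + q) ≡⟨ cong (gcd q) (+-comm p q) ⟩
  gcd q (q + p) ≡⟨ gcd[i,i+j]≡gcd[i,j] q p ⟩
  gcd q p       ≡⟨ gcd-comm q p ⟩
  gcd p q       ≡⟨ c ⟩
  + 1           ∎
  where open ≡-Reasoning

coprime[1+m,0]⇒m≡0 : ∀ {m} → Coprimeℤ (+ suc m) (+ 0) → m ≡ 0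
coprime[1+m,0]⇒m≡0 refl = refl

-- Residues modulo a positive integer

module _ (d : ℕ) .{{_ : ℕ.NonZero d}} where

  private
    quotient-≤ : ∀ {n a b} → a * + d ≤ n → n < sucℤ b * + d → a ≤ b
    quotient-≤ {b = b} ad≤n n<bd =
      subst (_ ≤_) (pred-suc b) (i<j⇒i≤pred[j] (*-cancelʳ-<-nonNeg {j = sucℤ b} (+ d) (≤-<-trans ad≤n n<bd)))

  [r+k*d]%ℕd≡r : ∀ {r} k → r ℕ.< d → (+ r + k * + d) %ℕ d ≡ r
  [r+k*d]%ℕd≡r {r} k r<d = +-injective (∙-cancelʳ (k * + d) _ _ residues)
    where
    n = + r + k * + d
    n<[k+1]d : n < sucℤ k * + d
    n<[k+1]d = subst (n <_) (≡.sym (suc-* k (+ d))) (+-monoˡ-< (k * + d) (+<+ r<d))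
    n/d≡k : n /ℕ d ≡ k
    n/d≡k = ≤-antisym (quotient-≤ ([n/ℕd]*d≤n n d) n<[k+1]d) (quotient-≤ (i≤j+i _ (+ r)) (n<s[n/ℕd]*d n d))
    residues : + (n %ℕ d) + k * + d ≡ + r + k * + d
    residues = subst (λ x → + (n %ℕ d) + x * + d ≡ n) n/d≡k (≡.sym (a≡a%ℕn+[a/ℕn]*n n d))

  [d+n]%ℕd≡n%ℕd : ∀ n → (+ d + n) %ℕ d ≡ n %ℕ d
  [d+n]%ℕd≡n%ℕd n = begin
    (+ d + n) %ℕ d               ≡⟨ cong (λ x → (+ d + x) %ℕ d) (a≡a%ℕn+[a/ℕn]*n n d) ⟩
    (+ d + (+ r + q * + d)) %ℕ d ≡⟨ cong (_%ℕ d) (absorb (+ d) (+ r) q) ⟩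
    (+ r + sucℤ q * + d) %ℕ d    ≡⟨ [r+k*d]%ℕd≡r (sucℤ q) (n%ℕd<d n d) ⟩
    r                            ∎
    where
    open ≡-Reasoning
    r = n %ℕ d
    q = n /ℕ d
    absorb : ∀ x r k → x + (r + k * x) ≡ r + (+ 1 + k) * x
    absorb = solve-∀

private
  step-up : ∀ p m q → p + (q + m * p) ≡ q + (+ 1 + m) * p
  step-up = solve-∀

  step-down : ∀ p m q → p + (q + - (+ 1 + m) * p) ≡ q + - m * p
  step-down = solve-∀

  no-step : ∀ p q → q ≡ q + + 0 * p
  no-step = solve-∀

module _ {ℓ} (p : ℤ) (Q : Pred ℤ ℓ) (up : ∀ q → Q q → Q (p + q)) (down : ∀ q → Q (p + q) → Q q) where

  private
    shift-up : ∀ n q → Q q → Q (q + + n * p)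
    shift-up zero    q h = subst Q (no-step p q) h
    shift-up (suc n) q h = subst Q (step-up p (+ n) q) (up _ (shift-up n q h))

    shift-down : ∀ n q → Q q → Q (q + - + n * p)
    shift-down zero    q h = subst Q (no-step p q) h
    shift-down (suc n) q h = down _ (subst Q (≡.sym (step-down p (+ n) q)) (shift-down n q h))

  shift-by : ∀ k q → Q q → Q (q + k * p)
  shift-by (+ n)    = shift-up n
  shift-by -[1+ n ] = shift-down (suc n)

from-residue : ∀ {ℓ} d .{{_ : ℕ.NonZero d}} (Q : Pred ℤ ℓ) →
               (∀ q → Q q → Q (+ d + q)) → (∀ q → Q (+ d + q) → Q q) →
               ∀ q → Q (+ (q %ℕ d)) → Q q
from-residue d Q up down q h =
  subst Q (≡.sym (a≡a%ℕn+[a/ℕn]*n q d)) (shift-by (+ d) Q up down (q /ℕ d) _ h)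

-- Induction over coprime pairs

module _ {ℓ} {P : ℤ → ℤ → Set ℓ} (rotate : ∀ p q → Coprimeℤ p q → P p q → P (- q) p) where

  private
    PositiveCase : Set ℓ
    PositiveCase = ∀ m q → Coprimeℤ (+ suc m) q → P (+ suc m) q

    negative : PositiveCase → ∀ m q → Coprimeℤ -[1+ m ] q → P -[1+ m ] q
    negative positive m q c = subst (P -[1+ m ]) (neg-involutive q)
      (rotate (- - q) (+ suc m) (coprime-rotate (+ suc m) (- q) c′)
        (rotate (+ suc m) (- q) c′ (positive m (- q) c′)))
      where c′ = coprime-neg -[1+ m ] q c

    from-positive : PositiveCase → ∀ p q → Coprimeℤ p q → P p q
    from-positive positive (+ suc m) q c = positive m q c
    from-positive positive -[1+ m ]  q c = negative positive m q c
    from-positive positive (+ zero) (+ zero) ()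
    from-positive positive (+ zero) q@(+ suc k) c =
      rotate q (+ 0) (coprime-sym (+ 0) q c) (positive k (+ 0) (coprime-sym (+ 0) q c))
    from-positive positive (+ zero) q@(-[1+ k ]) c =
      rotate q (+ 0) (coprime-sym (+ 0) q c) (negative positive k (+ 0) (coprime-sym (+ 0) q c))

  euclidean-induction :
    (∀ p q → Coprimeℤ p q → P p q → P (p + q) q → P p (p + q)) →
    (∀ m r → r ℕ.≤ m → Coprimeℤ (+ suc m) (+ r) → P (+ suc m) (+ r)) →
    ∀ p q → Coprimeℤ p q → P p q
  euclidean-induction shift reduced = from-positive positive
    where
    first-quadrant : ∀ m j → Coprimeℤ (+ suc m) (+ j) → P (+ suc m) (+ j)
    first-quadrant m = <-rec (λ j → Coprimeℤ p (+ j) → P p (+ j)) step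
      where
      p = + suc m
      step : ∀ j → (∀ {k} → k ℕ.< j → Coprimeℤ p (+ k) → P p (+ k)) → Coprimeℤ p (+ j) → P p (+ j)
      step j ih c with j ℕ.≤? m
      ... | yes j≤m = reduced m j j≤m c
      ... | no j≰m with ℕ.m≤n⇒∃[o]m+o≡n (ℕ.≰⇒> j≰m)
      ...   | k , refl =
        shift p (+ k) c′ (ih (ℕ.m<n+m k z<s) c′)
          (reduced (m ℕ.+ k) k (ℕ.m≤n+m k m) (coprime-sum p (+ k) c′))
        where c′ = coprime-unshift p (+ k) c

    positive : ∀ m q → Coprimeℤ (+ suc m) q → P (+ suc m) q
    positive m (+ j)    c = first-quadrant m j c
    positive m -[1+ k ] c =
      rotate -[1+ k ] -[1+ m ] c₂ (rotate -[1+ m ] (+ suc k) c₁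
        (rotate (+ suc k) (+ suc m) c₀ (first-quadrant k (suc m) c₀)))
      where
      c₀ = coprime-rotate (+ suc m) -[1+ k ] c
      c₁ = coprime-rotate (+ suc k) (+ suc m) c₀
      c₂ = coprime-rotate -[1+ m ] (+ suc k) c₁

  orbit-induction :
    (∀ p q → Coprimeℤ p q → P p q → P p (p + q)) →
    (∀ p q → Coprimeℤ p q → P p (p + q) → P p q) →
    P (+ 1) (+ 0) →
    ∀ p q → Coprimeℤ p q → P p q
  orbit-induction translate untranslate base = from-positive (<-rec _ step)
    where
    step : ∀ m → (∀ {k} → k ℕ.< m → ∀ q → Coprimeℤ (+ suc k) q → P (+ suc k) q) →
           ∀ q → Coprimeℤ (+ suc m) q → P (+ suc m) q
    step m ih q =
      from-residue (suc m) (λ x → Coprimeℤ p x → P p x) up down q (reduced (q %ℕ suc m) (n%ℕd<d q (suc m)))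
      where
      p = + suc m
      up : ∀ x → (Coprimeℤ p x → P p x) → Coprimeℤ p (p + x) → P p (p + x)
      up x h c = translate p x (coprime-unshift p x c) (h (coprime-unshift p x c))
      down : ∀ x → (Coprimeℤ p (p + x) → P p (p + x)) → Coprimeℤ p x → P p x
      down x h c = untranslate p x c (h (coprime-shift p x c))
      reduced : ∀ r → r ℕ.< suc m → Coprimeℤ p (+ r) → P p (+ r)
      reduced zero    _   c = subst (λ n → P (+ suc n) (+ 0)) (≡.sym (coprime[1+m,0]⇒m≡0 c)) base
      reduced (suc k) k<m c = rotate (+ suc k) -[1+ m ] c′ (ih (ℕ.s≤s⁻¹ k<m) -[1+ m ] c′)
        where c′ = coprime-unrotate (+ suc k) -[1+ m ] c

-- Multiple Dedekind symbols and reciprocity functions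

private
  -q+[p+q]≡p : ∀ p q → - q + (p + q) ≡ p
  -q+[p+q]≡p = solve-∀

  -[p+q]+p≡-q : ∀ p q → - (p + q) + p ≡ - q
  -[p+q]+p≡-q = solve-∀

module MultipleDedekindSymbols {c ℓ a : Level} (R : CommutativeRing c ℓ) (𝒜 : Set a) where
  open CommutativeRing R using (1#; *-cong; *-identityʳ; *-identityˡ)
    renaming (sym to ≈-sym; trans to ≈-trans)
  open MultipleDedekind R 𝒜
  open SeriesMonoid R 𝒜
  open import Algebra.Properties.Monoid ⊛-monoid using (insertʳ; cancelˡ; cancelʳ; cancelᶜ)
  open ≈ₛ-Reasoning

  FlipInvariant : SymbolFn → Set (a ⊔ ℓ)
  FlipInvariant D = ∀ p q → Coprimeℤ p q → D p (- q) ≈ₛ D (- p) q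

  Periodic : SymbolFn → Set (a ⊔ ℓ)
  Periodic D = ∀ p q → Coprimeℤ p q → D p q ≈ₛ D p (p + q)

  InverseUnderRotation : SymbolFn → Set (a ⊔ ℓ)
  InverseUnderRotation F = ∀ p q → Coprimeℤ p q → (F p q ⊛ F (- q) p) ≈ₛ one

  ThreeTerm : SymbolFn → Set (a ⊔ ℓ)
  ThreeTerm F = ∀ p q → Coprimeℤ p q → (F p (p + q) ⊛ F (p + q) q) ≈ₛ F p q

  Reciprocal : SymbolFn → SymbolFn → ℤ → ℤ → Set (a ⊔ ℓ)
  Reciprocal F D p q = D p q ≈ₛ (F p q ⊛ D (- q) p)

  flip⇒even : ∀ D → FlipInvariant D → ∀ p q → Coprimeℤ p q → D (- p) (- q) ≈ₛ D p q
  flip⇒even D flip p q c =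
    subst (λ x → D (- p) (- q) ≈ₛ D x q) (neg-involutive p) (flip (- p) q (coprime-negˡ p q c))

  module DedekindSymmetries {D} (flip : FlipInvariant D) (periodic : Periodic D) where

    D[-q,p]≈D[-q,p+q] : ∀ p q → Coprimeℤ p q → D (- q) p ≈ₛ D (- q) (p + q)
    D[-q,p]≈D[-q,p+q] p q c = begin
      D (- q) p               ≡⟨ cong (D (- q)) (-q+[p+q]≡p p q) ⟨
      D (- q) (- q + (p + q)) ≈⟨ periodic (- q) (p + q) (coprime-rotate (p + q) q (coprime-sum p q c)) ⟨
      D (- q) (p + q)         ∎

    D[-p-q,p]≈D[p+q,q] : ∀ p q → Coprimeℤ p q → D (- (p + q)) p ≈ₛ D (p + q) q
    D[-p-q,p]≈D[p+q,q] p q c = begin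
      D (- (p + q)) p               ≈⟨ periodic (- (p + q)) p (coprime-rotate p (p + q) (coprime-shift p q c)) ⟩
      D (- (p + q)) (- (p + q) + p) ≡⟨ cong (D (- (p + q))) (-[p+q]+p≡-q p q) ⟩
      D (- (p + q)) (- q)           ≈⟨ flip⇒even D flip (p + q) q (coprime-sum p q c) ⟩
      D (p + q) q                   ∎

  module ReciprocalLaw {F D} (F-flip : FlipInvariant F) (F-inverse : InverseUnderRotation F)
                       (F-three-term : ThreeTerm F) (D-flip : FlipInvariant D) (D-periodic : Periodic D) where
    open DedekindSymmetries D-flip D-periodic

    reciprocal-rotate : ∀ p q → Coprimeℤ p q → Reciprocal F D p q → Reciprocal F D (- q) p
    reciprocal-rotate p q c h = ≈ₛ-sym (begin
      F (- q) p ⊛ D (- p) (- q)       ≈⟨ ⊛-congˡ (flip⇒even D D-flip p q c) ⟩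
      F (- q) p ⊛ D p q               ≈⟨ ⊛-congˡ h ⟩
      F (- q) p ⊛ (F p q ⊛ D (- q) p) ≈⟨ cancelˡ F[-q,p]F[p,q]≈1 (D (- q) p) ⟩
      D (- q) p                       ∎)
      where
      F[-q,p]F[p,q]≈1 : (F (- q) p ⊛ F p q) ≈ₛ one
      F[-q,p]F[p,q]≈1 = ≈ₛ-trans (⊛-congˡ (≈ₛ-sym (flip⇒even F F-flip p q c)))
                                 (F-inverse (- q) p (coprime-rotate p q c))

    reciprocal-shift : ∀ p q → Coprimeℤ p q →
                       Reciprocal F D p q → Reciprocal F D (p + q) q → Reciprocal F D p (p + q)
    reciprocal-shift p q c h h′ = begin
      D p (p + q)                                   ≈⟨ D-periodic p q c ⟨
      D p q                                         ≈⟨ h ⟩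
      F p q ⊛ D (- q) p                             ≈⟨ ⊛-congʳ (F-three-term p q c) ⟨
      (F p (p + q) ⊛ F (p + q) q) ⊛ D (- q) p       ≈⟨ ⊛-assoc _ _ _ ⟩
      F p (p + q) ⊛ (F (p + q) q ⊛ D (- q) p)       ≈⟨ ⊛-congˡ (⊛-congˡ (D[-q,p]≈D[-q,p+q] p q c)) ⟩
      F p (p + q) ⊛ (F (p + q) q ⊛ D (- q) (p + q)) ≈⟨ ⊛-congˡ h′ ⟨
      F p (p + q) ⊛ D (p + q) q                     ≈⟨ ⊛-congˡ (D[-p-q,p]≈D[p+q,q] p q c) ⟨
      F p (p + q) ⊛ D (- (p + q)) p                 ∎

  reciprocal-assoc : ∀ D → HasConstOne D → ∀ p q → Coprimeℤ p q → Reciprocal (assoc D) D p q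
  reciprocal-assoc D D-const p q c = insertʳ (inv-inverseˡ (D-const (- q) p (coprime-rotate p q c))) (D p q)

  assoc-reciprocity : ∀ D → IsMultipleDedekindSymbol D → IsMultipleReciprocityFunction (assoc D)
  assoc-reciprocity D (D-const , D-flip , D-periodic) = F-const , F-flip , F-inverse , F-three-term
    where
    open DedekindSymmetries D-flip D-periodic

    const-rotate : ∀ p q → Coprimeℤ p q → ConstOne (D (- q) p)
    const-rotate p q c = D-const (- q) p (coprime-rotate p q c)

    telescope : ∀ {A X X′ B} → ConstOne X → X ≈ₛ X′ → ((A ⊛ inv X) ⊛ (X′ ⊛ B)) ≈ₛ (A ⊛ B)
    telescope {A} {B = B} X-const X≈X′ =
      ≈ₛ-trans (⊛-congˡ (⊛-congʳ (≈ₛ-sym X≈X′))) (cancelᶜ (inv-inverseˡ X-const) A B)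

    F-const : HasConstOne (assoc D)
    F-const p q c = ≈-trans (*-identityʳ _) (D-const p q c)

    F-flip : FlipInvariant (assoc D)
    F-flip p q c = ⊛-cong (D-flip p q c)
      (inv-cong (D-const (- - q) p (coprime-negˡ (- q) p c′)) (≈ₛ-sym (D-flip (- q) p c′)))
      where c′ = coprime-rotate p q c

    F-inverse : InverseUnderRotation (assoc D)
    F-inverse p q c = begin
      (D p q ⊛ inv (D (- q) p)) ⊛ (D (- q) p ⊛ inv (D (- p) (- q)))
        ≈⟨ telescope (const-rotate p q c) ≈ₛ-refl ⟩
      D p q ⊛ inv (D (- p) (- q))
        ≈⟨ ⊛-congˡ (inv-cong (const-rotate (- q) p (coprime-rotate p q c)) (flip⇒even D D-flip p q c)) ⟩
      D p q ⊛ inv (D p q)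
        ≈⟨ inv-inverseʳ (D-const p q c) ⟩
      one ∎

    F-three-term : ThreeTerm (assoc D)
    F-three-term p q c = begin
      (D p (p + q) ⊛ inv (D (- (p + q)) p)) ⊛ (D (p + q) q ⊛ inv (D (- q) (p + q)))
        ≈⟨ telescope (const-rotate p (p + q) (coprime-shift p q c)) (D[-p-q,p]≈D[p+q,q] p q c) ⟩
      D p (p + q) ⊛ inv (D (- q) (p + q))
        ≈⟨ ⊛-cong (≈ₛ-sym (D-periodic p q c))
                  (inv-cong (const-rotate (p + q) q (coprime-sum p q c)) (≈ₛ-sym (D[-q,p]≈D[-q,p+q] p q c))) ⟩
      D p q ⊛ inv (D (- q) p) ∎

  assoc-injective : ∀ D D′ → IsNormalizedMultipleDedekindSymbol D → IsNormalizedMultipleDedekindSymbol D′ →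
                    assoc D ≈U assoc D′ → D ≈U D′
  assoc-injective D D′ ((D-const , D-flip , D-periodic) , D-normalized)
                       ((D′-const , D′-flip , D′-periodic) , D′-normalized) F≈F′ =
    orbit-induction rotate translate untranslate base
    where
    rotate : ∀ p q → Coprimeℤ p q → D p q ≈ₛ D′ p q → D (- q) p ≈ₛ D′ (- q) p
    rotate p q c h = begin
      D (- q) p                         ≈⟨ reciprocal-assoc D D-const (- q) p c′ ⟩
      assoc D (- q) p ⊛ D (- p) (- q)   ≈⟨ ⊛-cong (F≈F′ (- q) p c′) (flip⇒even D D-flip p q c) ⟩
      assoc D′ (- q) p ⊛ D p q          ≈⟨ ⊛-congˡ h ⟩
      assoc D′ (- q) p ⊛ D′ p q         ≈⟨ ⊛-congˡ (flip⇒even D′ D′-flip p q c) ⟨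
      assoc D′ (- q) p ⊛ D′ (- p) (- q) ≈⟨ reciprocal-assoc D′ D′-const (- q) p c′ ⟨
      D′ (- q) p                        ∎
      where c′ = coprime-rotate p q c

    translate : ∀ p q → Coprimeℤ p q → D p q ≈ₛ D′ p q → D p (p + q) ≈ₛ D′ p (p + q)
    translate p q c h = ≈ₛ-trans (≈ₛ-sym (D-periodic p q c)) (≈ₛ-trans h (D′-periodic p q c))

    untranslate : ∀ p q → Coprimeℤ p q → D p (p + q) ≈ₛ D′ p (p + q) → D p q ≈ₛ D′ p q
    untranslate p q c h = ≈ₛ-trans (D-periodic p q c) (≈ₛ-trans h (≈ₛ-sym (D′-periodic p q c)))

    base : D (+ 1) (+ 0) ≈ₛ D′ (+ 1) (+ 0)
    base = begin
      D (+ 1) (+ 0)  ≈⟨ D-periodic (+ 1) (+ 0) refl ⟩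
      D (+ 1) (+ 1)  ≈⟨ D-normalized ⟩
      one            ≈⟨ D′-normalized ⟨
      D′ (+ 1) (+ 1) ≈⟨ D′-periodic (+ 1) (+ 0) refl ⟨
      D′ (+ 1) (+ 0) ∎

  module Construction (F : SymbolFn) (F-const : HasConstOne F) (F-flip : FlipInvariant F)
                      (F-inverse : InverseUnderRotation F) (F-three-term : ThreeTerm F) where

    -- euclid t n q computes D(n, q) once the fuel t is at least n; the recursive call is D(r, -p),
    -- which flip-invariance identifies with the D(-r, p) of the reciprocity law.
    euclid : ℕ → ℕ → ℤ → Series
    euclid _       zero    q = F (+ 0) q
    euclid zero    (suc _) _ = one
    euclid (suc t) (suc m) q = F (+ suc m) (+ r) ⊛ euclid t r -[1+ m ]
      where r = q %ℕ suc m

    D : SymbolFn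
    D (+ n)    q = euclid n n q
    D -[1+ m ] q = euclid (suc m) (suc m) (- q)

    euclid-fuel : ∀ t t′ n q → n ℕ.≤ t → n ℕ.≤ t′ → euclid t n q ≡ euclid t′ n q
    euclid-fuel _       _        zero    _ _         _          = refl
    euclid-fuel (suc t) (suc t′) (suc m) q (s≤s m≤t) (s≤s m≤t′) =
      cong (F (+ suc m) (+ r) ⊛_)
           (euclid-fuel t t′ r -[1+ m ] (ℕ.≤-trans r≤m m≤t) (ℕ.≤-trans r≤m m≤t′))
      where
      r = q %ℕ suc m
      r≤m = ℕ.s≤s⁻¹ (n%ℕd<d q (suc m))

    D-unfold : ∀ m q → let r = q %ℕ suc m in D (+ suc m) q ≡ F (+ suc m) (+ r) ⊛ D (+ r) -[1+ m ]
    D-unfold m q =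
      cong (F (+ suc m) (+ r) ⊛_) (euclid-fuel m r r -[1+ m ] (ℕ.s≤s⁻¹ (n%ℕd<d q (suc m))) ℕ.≤-refl)
      where r = q %ℕ suc m

    euclid-periodic : ∀ m q → euclid (suc m) (suc m) (+ suc m + q) ≡ euclid (suc m) (suc m) q
    euclid-periodic m q = cong (λ r → F (+ suc m) (+ r) ⊛ euclid m r -[1+ m ]) ([d+n]%ℕd≡n%ℕd (suc m) q)

    D-flip : FlipInvariant D
    D-flip (+ zero)  q c = F-flip (+ 0) q c
    D-flip (+ suc m) q c = ≈ₛ-refl
    D-flip -[1+ m ]  q c = ≈ₛ-reflexive (cong (euclid (suc m) (suc m)) (neg-involutive q))

    D-periodic : Periodic D
    D-periodic (+ zero)  q c = ≈ₛ-reflexive (cong (F (+ 0)) (≡.sym (+-identityˡ q)))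
    D-periodic (+ suc m) q c = ≈ₛ-reflexive (≡.sym (euclid-periodic m q))
    D-periodic -[1+ m ]  q c = begin
      euclid (suc m) (suc m) (- q)              ≡⟨ euclid-periodic m (- q) ⟨
      euclid (suc m) (suc m) (+ suc m + - q)    ≡⟨ cong (euclid (suc m) (suc m)) (neg-distrib-+ -[1+ m ] q) ⟨
      euclid (suc m) (suc m) (- (-[1+ m ] + q)) ∎

    reduced : ∀ m r → r ℕ.≤ m → Coprimeℤ (+ suc m) (+ r) → Reciprocal F D (+ suc m) (+ r)
    reduced m r r≤m c = begin
      D (+ suc m) (+ r)
        ≡⟨ D-unfold m (+ r) ⟩
      F (+ suc m) (+ (r ℕ.% suc m)) ⊛ D (+ (r ℕ.% suc m)) -[1+ m ]
        ≡⟨ cong (λ x → F (+ suc m) (+ x) ⊛ D (+ x) -[1+ m ]) (ℕ.m≤n⇒m%n≡m r≤m) ⟩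
      F (+ suc m) (+ r) ⊛ D (+ r) -[1+ m ]
        ≈⟨ ⊛-congˡ (D-flip (+ r) (+ suc m) (coprime-sym (+ suc m) (+ r) c)) ⟩
      F (+ suc m) (+ r) ⊛ D (- + r) (+ suc m) ∎

    reciprocal : ∀ p q → Coprimeℤ p q → Reciprocal F D p q
    reciprocal = euclidean-induction reciprocal-rotate reciprocal-shift reduced
      where open ReciprocalLaw F-flip F-inverse F-three-term D-flip D-periodic

    D-const : HasConstOne D
    D-const = orbit-induction rotate translate untranslate base
      where
      rotate : ∀ p q → Coprimeℤ p q → ConstOne (D p q) → ConstOne (D (- q) p)
      rotate p q c h = ≈-trans (reciprocal (- q) p c′ [])
        (≈-trans (*-cong (F-const (- q) p c′) (≈-trans (flip⇒even D D-flip p q c []) h)) (*-identityˡ 1#))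
        where c′ = coprime-rotate p q c

      translate : ∀ p q → Coprimeℤ p q → ConstOne (D p q) → ConstOne (D p (p + q))
      translate p q c = ≈-trans (≈-sym (D-periodic p q c []))

      untranslate : ∀ p q → Coprimeℤ p q → ConstOne (D p (p + q)) → ConstOne (D p q)
      untranslate p q c = ≈-trans (D-periodic p q c [])

      base : ConstOne (D (+ 1) (+ 0))
      base = ≈-trans (*-cong (F-const (+ 1) (+ 0) refl) (F-const (+ 0) -[1+ 0 ] refl)) (*-identityˡ 1#)

    D-normalized : D (+ 1) (+ 1) ≈ₛ one
    D-normalized = ≈ₛ-trans (⊛-congˡ (F-flip (+ 0) (+ 1) refl)) (F-inverse (+ 1) (+ 0) refl)

    isNormalized : IsNormalizedMultipleDedekindSymbol D
    isNormalized = (D-const , D-flip , D-periodic) , D-normalized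

    assoc-D : assoc D ≈U F
    assoc-D p q c = ≈ₛ-trans (⊛-congʳ (reciprocal p q c))
                             (cancelʳ (inv-inverseʳ (D-const (- q) p (coprime-rotate p q c))) (F p q))

  assoc-surjective : ∀ F → IsMultipleReciprocityFunction F →
                     Σ[ D ∈ SymbolFn ] (IsNormalizedMultipleDedekindSymbol D × assoc D ≈U F)
  assoc-surjective F (F-const , F-flip , F-inverse , F-three-term) = D , isNormalized , assoc-D
    where open Construction F F-const F-flip F-inverse F-three-term

theorem3p5 : {c ℓ a : Level} (R : CommutativeRing c ℓ) (𝒜 : Set a) →
    let open MultipleDedekind R 𝒜 in
    -- the map lands in multiple reciprocity functions
    ((D : SymbolFn) → IsNormalizedMultipleDedekindSymbol D →
        IsMultipleReciprocityFunction (assoc D))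
    -- injective (on U)
    × ((D D' : SymbolFn) → IsNormalizedMultipleDedekindSymbol D →
        IsNormalizedMultipleDedekindSymbol D' → assoc D ≈U assoc D' → D ≈U D')
    -- surjective
    × ((F : SymbolFn) → IsMultipleReciprocityFunction F →
        Σ[ D ∈ SymbolFn ] (IsNormalizedMultipleDedekindSymbol D × assoc D ≈U F))
theorem3p5 R 𝒜 = (λ D (isD , _) → assoc-reciprocity D isD) , assoc-injective , assoc-surjective
  where open MultipleDedekindSymbols R 𝒜
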